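{- Let $n\geq 2$ be an integer, $\Lambda$ an index set, and $J_\lambda$ a quiver for each $\lambda\in\Lambda$. Then the disjoint union $\coprod_{\lambda\in\Lambda}J_\lambda$ is $\phi_n$-injective if and only if $J_\lambda$ is $\phi_n$-injective for every $\lambda\in\Lambda$.
   Context: A quiver is a quadruple $(V,E,\sigma,\tau)$ with $V,E$ sets and $\sigma,\tau:E\to V$ functions (source and target); quiver homomorphisms are pairs of vertex and edge maps commuting with sources and targets. The disjoint union of quivers has as vertex and edge sets the disjoint unions of the vertex and edge sets, with source and target maps induced componentwise. The directed path $P_n$ has vertices $a_1,\dots,a_n$ and edges $x_1,\dots,x_{n-1}$ with $x_k$ from $a_k$ to $a_{k+1}$; the directed cycle $C_n$ has vertices $a_1,\dots,a_n$ and edges $x_1,\dots,x_n$ with $x_k$ from $a_k$ to $a_{k+1}$ for $k<n$ and $x_n$ from $a_n$ to $a_1$. $\phi_n:P_n\to C_n$ is the inclusion. A quiver $J$ is $\phi_n$-injective if for every quiver homomorphism $\psi:P_n\to J$ there exists a quiver homomorphism $\hat\psi:C_n\to J$ with $\hat\psi\circ\phi_n=\psi$. -}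

module Defs where

open import Level using (Level; _⊔_)
open import Data.Empty using (⊥)
open import Relation.Binary.PropositionalEquality using (refl; cong; trans)
open import Data.Nat using (ℕ; zero; suc)
open import Data.Fin using (Fin; zero; suc; inject₁; fromℕ)
open import Data.Product using (Σ; _,_; proj₁; proj₂)
open import Relation.Binary.PropositionalEquality using (_≡_)
open import Function using (_∘_; id)

record Quiver (v e : Level) : Set (Level.suc (v ⊔ e)) where
  field
    V : Set v
    E : Set e
    σ : E → V
    τ : E → V
open Quiver public

record Hom {v e v' e' : Level} (Q : Quiver v e) (R : Quiver v' e')
       : Set (v ⊔ e ⊔ v' ⊔ e') where
  field
    fV : V Q → V R
    fE : E Q → E R
    comm-σ : ∀ x → fV (σ Q x) ≡ σ R (fE x)
    comm-τ : ∀ x → fV (τ Q x) ≡ τ R (fE x)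
open Hom public

_∘H_ : ∀ {a b c d e f} {Q : Quiver a b} {R : Quiver c d} {S : Quiver e f}
       → Hom R S → Hom Q R → Hom Q S
_∘H_ {S = S} g h = record
  { fV = fV g ∘ fV h
  ; fE = fE g ∘ fE h
  ; comm-σ = λ x → trans (cong (fV g) (comm-σ h x)) (comm-σ g (fE h x))
  ; comm-τ = λ x → trans (cong (fV g) (comm-τ h x)) (comm-τ g (fE h x))
  }

record _≈H_ {a b c d} {Q : Quiver a b} {R : Quiver c d} (f g : Hom Q R) : Set (a ⊔ b ⊔ c ⊔ d) where
  field
    ≈V : ∀ x → fV f x ≡ fV g x
    ≈E : ∀ x → fE f x ≡ fE g x

PEdge : ℕ → Set
PEdge zero = ⊥
PEdge (suc k) = Fin k

Pσ : (n : ℕ) → PEdge n → Fin n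
Pσ zero ()
Pσ (suc k) i = inject₁ i

Pτ : (n : ℕ) → PEdge n → Fin n
Pτ zero ()
Pτ (suc k) i = suc i

-- Directed path P_n: vertices a_1..a_n as Fin n, edge x_k : a_k → a_{k+1}.
P : ℕ → Quiver Level.zero Level.zero
P n = record { V = Fin n ; E = PEdge n ; σ = Pσ n ; τ = Pτ n }

-- Cyclic successor on Fin n: a_k ↦ a_{k+1} for k < n, and a_n ↦ a_1.
next : (n : ℕ) → Fin n → Fin n
next (suc zero) zero = zero
next (suc (suc k)) zero = suc zero
next (suc (suc k)) (suc i) with next (suc k) i
... | zero = zero
... | suc j = suc (suc j)

C : ℕ → Quiver Level.zero Level.zero
C n = record { V = Fin n ; E = Fin n ; σ = id ; τ = next n }

φ : (n : ℕ) → Hom (P n) (C n)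
φ zero = record { fV = id ; fE = λ () ; comm-σ = λ () ; comm-τ = λ () }
φ (suc k) = record { fV = id ; fE = inject₁ ; comm-σ = λ _ → refl ; comm-τ = λ i → nextInj k i }
  where
  nextInj : (k : ℕ) (i : Fin k) → suc i ≡ next (suc k) (inject₁ i)
  nextInj (suc zero) zero = refl
  nextInj (suc (suc k)) zero = refl
  nextInj (suc (suc k)) (suc i) with next (suc (suc k)) (inject₁ i) | nextInj (suc k) i
  ... | suc j | refl = refl

φ-injective : ∀ {v e} → ℕ → Quiver v e → Set (v ⊔ e)
φ-injective n J = (ψ : Hom (P n) J) → Σ (Hom (C n) J) (λ ψ̂ → (ψ̂ ∘H φ n) ≈H ψ)

∐ : ∀ {ℓ v e} (Λ : Set ℓ) → (Λ → Quiver v e) → Quiver (ℓ ⊔ v) (ℓ ⊔ e)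
∐ Λ J = record
  { V = Σ Λ (λ l → V (J l))
  ; E = Σ Λ (λ l → E (J l))
  ; σ = λ { (l , x) → (l , σ (J l) x) }
  ; τ = λ { (l , x) → (l , τ (J l) x) }
  }

-- A homomorphism into a disjoint union sends each connected component of its
-- domain into a single summand, through which it then factors. For n ≥ 1 the
-- path P_n is connected and φ_n is the identity on vertices, so a path in ∐ J
-- and any extension of it along φ_n both live in one summand J_λ: extension
-- problems along φ_n for ∐ J are exactly those for the summands.
module Submission where

open import Defs
open import Level using (Level)
open import Data.Nat using (ℕ; zero; suc; _≤_)
open import Data.Fin using (Fin; zero; suc)
open import Data.Product using (Σ; _×_; _,_; proj₁; proj₂)
open import Data.Product.Properties.WithK using (,-injectiveʳ)
open import Function using (_∘′_)
open import Relation.Binary.PropositionalEquality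
open ≡-Reasoning

module _ {a b c d} {Q : Quiver a b} {R : Quiver c d} where

  ≈H-sym : {f g : Hom Q R} → f ≈H g → g ≈H f
  ≈H-sym f≈g = record
    { ≈V = λ x → sym (_≈H_.≈V f≈g x)
    ; ≈E = λ x → sym (_≈H_.≈E f≈g x)
    }

  ≈H-trans : {f g h : Hom Q R} → f ≈H g → g ≈H h → f ≈H h
  ≈H-trans f≈g g≈h = record
    { ≈V = λ x → trans (_≈H_.≈V f≈g x) (_≈H_.≈V g≈h x)
    ; ≈E = λ x → trans (_≈H_.≈E f≈g x) (_≈H_.≈E g≈h x)
    }

  ∘H-congʳ : ∀ {a′ b′} {S : Quiver a′ b′} {f g : Hom Q R} (k : Hom S Q)
    → f ≈H g → (f ∘H k) ≈H (g ∘H k)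
  ∘H-congʳ k f≈g = record
    { ≈V = λ x → _≈H_.≈V f≈g (fV k x)
    ; ≈E = λ x → _≈H_.≈E f≈g (fE k x)
    }

fV-φ : (n : ℕ) (x : Fin n) → fV (φ n) x ≡ x
fV-φ zero    x = refl
fV-φ (suc n) x = refl

P-edge-invariant⇒constant : ∀ {a} {A : Set a} (k : ℕ) (g : Fin (suc k) → A)
  → (∀ i → g (σ (P (suc k)) i) ≡ g (τ (P (suc k)) i)) → ∀ x → g x ≡ g zero
P-edge-invariant⇒constant k       g inv zero    = refl
P-edge-invariant⇒constant (suc k) g inv (suc x) = begin
  g (suc x)    ≡⟨ P-edge-invariant⇒constant k (λ y → g (suc y)) (λ i → inv (suc i)) x ⟩
  g (suc zero) ≡⟨ sym (inv zero) ⟩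
  g zero       ∎

restrict : ∀ {ℓ a} {Λ : Set ℓ} {A : Λ → Set a} {l : Λ} (w : Σ Λ A) → proj₁ w ≡ l → A l
restrict (l , x) refl = x

restrict-≡ : ∀ {ℓ a} {Λ : Set ℓ} {A : Λ → Set a} {l : Λ} (w : Σ Λ A) (p : proj₁ w ≡ l)
  → (l , restrict w p) ≡ w
restrict-≡ (l , x) refl = refl

module _ {ℓ v e} {Λ : Set ℓ} (J : Λ → Quiver v e) where

  ι : ∀ {a b} {Q : Quiver a b} (l : Λ) → Hom Q (J l) → Hom Q (∐ Λ J)
  ι l f = record
    { fV = λ x → l , fV f x
    ; fE = λ x → l , fE f x
    ; comm-σ = λ x → cong (l ,_) (comm-σ f x)
    ; comm-τ = λ x → cong (l ,_) (comm-τ f x)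
    }

  module _ {a b} {Q : Quiver a b} (l : Λ) where

    ι-cong : {f g : Hom Q (J l)} → f ≈H g → ι l f ≈H ι l g
    ι-cong f≈g = record
      { ≈V = λ x → cong (l ,_) (_≈H_.≈V f≈g x)
      ; ≈E = λ x → cong (l ,_) (_≈H_.≈E f≈g x)
      }

    ι-∘H : ∀ {a′ b′} {S : Quiver a′ b′} (f : Hom Q (J l)) (k : Hom S Q)
      → ι l (f ∘H k) ≈H (ι l f ∘H k)
    ι-∘H f k = record { ≈V = λ _ → refl ; ≈E = λ _ → refl }

    ι-reflects-≈H : {f g : Hom Q (J l)} → ι l f ≈H ι l g → f ≈H g
    ι-reflects-≈H f≈g = record
      { ≈V = λ x → ,-injectiveʳ (_≈H_.≈V f≈g x)
      ; ≈E = λ x → ,-injectiveʳ (_≈H_.≈E f≈g x)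
      }

    ι-factor : (f : Hom Q (∐ Λ J)) → (∀ x → proj₁ (fV f x) ≡ l)
      → Σ (Hom Q (J l)) (λ h → ι l h ≈H f)
    ι-factor f vertexIn = h , record { ≈V = ≈V ; ≈E = ≈E }
      where
      edgeIn : ∀ x → proj₁ (fE f x) ≡ l
      edgeIn x = trans (cong proj₁ (sym (comm-σ f x))) (vertexIn (σ Q x))

      ≈V : ∀ x → (l , restrict (fV f x) (vertexIn x)) ≡ fV f x
      ≈V x = restrict-≡ (fV f x) (vertexIn x)

      ≈E : ∀ x → (l , restrict (fE f x) (edgeIn x)) ≡ fE f x
      ≈E x = restrict-≡ (fE f x) (edgeIn x)

      h : Hom Q (J l)
      h = record
        { fV = λ x → restrict (fV f x) (vertexIn x)
        ; fE = λ x → restrict (fE f x) (edgeIn x)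
        ; comm-σ = λ x → ,-injectiveʳ (begin
            _                   ≡⟨ ≈V (σ Q x) ⟩
            fV f (σ Q x)        ≡⟨ comm-σ f x ⟩
            σ (∐ Λ J) (fE f x)  ≡⟨ cong (σ (∐ Λ J)) (sym (≈E x)) ⟩
            _                   ∎)
        ; comm-τ = λ x → ,-injectiveʳ (begin
            _                   ≡⟨ ≈V (τ Q x) ⟩
            fV f (τ Q x)        ≡⟨ comm-τ f x ⟩
            τ (∐ Λ J) (fE f x)  ≡⟨ cong (τ (∐ Λ J)) (sym (≈E x)) ⟩
            _                   ∎)
        }

  ∐-component-edge-invariant : ∀ {a b} {Q : Quiver a b} (f : Hom Q (∐ Λ J)) (x : E Q)
    → proj₁ (fV f (σ Q x)) ≡ proj₁ (fV f (τ Q x))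
  ∐-component-edge-invariant f x =
    trans (cong proj₁ (comm-σ f x)) (sym (cong proj₁ (comm-τ f x)))

  ∐-φ-injective⇒φ-injective : ∀ n → φ-injective n (∐ Λ J) → ∀ l → φ-injective n (J l)
  ∐-φ-injective⇒φ-injective n inj l ψ =
    h , ι-reflects-≈H l (≈H-trans (ι-∘H l h (φ n)) (≈H-trans (∘H-congʳ (φ n) ιh≈ψ̂) ψ̂φ≈ιψ))
    where
    ψ̂ : Hom (C n) (∐ Λ J)
    ψ̂ = proj₁ (inj (ι l ψ))

    ψ̂φ≈ιψ : (ψ̂ ∘H φ n) ≈H ι l ψ
    ψ̂φ≈ιψ = proj₂ (inj (ι l ψ))

    ψ̂-in-l : ∀ x → proj₁ (fV ψ̂ x) ≡ l
    ψ̂-in-l x = begin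
      proj₁ (fV ψ̂ x)             ≡⟨ cong (proj₁ ∘′ fV ψ̂) (sym (fV-φ n x)) ⟩
      proj₁ (fV ψ̂ (fV (φ n) x))  ≡⟨ cong proj₁ (_≈H_.≈V ψ̂φ≈ιψ x) ⟩
      l                          ∎

    h : Hom (C n) (J l)
    h = proj₁ (ι-factor l ψ̂ ψ̂-in-l)

    ιh≈ψ̂ : ι l h ≈H ψ̂
    ιh≈ψ̂ = proj₂ (ι-factor l ψ̂ ψ̂-in-l)

  φ-injective⇒∐-φ-injective : ∀ k → (∀ l → φ-injective (suc k) (J l))
    → φ-injective (suc k) (∐ Λ J)
  φ-injective⇒∐-φ-injective k inj ψ =
    ι l h , ≈H-trans (≈H-sym (ι-∘H l h (φ (suc k)))) (≈H-trans (ι-cong l hφ≈ψₗ) ιψₗ≈ψ)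
    where
    l : Λ
    l = proj₁ (fV ψ zero)

    ψ-in-l : ∀ x → proj₁ (fV ψ x) ≡ l
    ψ-in-l = P-edge-invariant⇒constant k (proj₁ ∘′ fV ψ) (∐-component-edge-invariant ψ)

    ψₗ : Hom (P (suc k)) (J l)
    ψₗ = proj₁ (ι-factor l ψ ψ-in-l)

    ιψₗ≈ψ : ι l ψₗ ≈H ψ
    ιψₗ≈ψ = proj₂ (ι-factor l ψ ψ-in-l)

    h : Hom (C (suc k)) (J l)
    h = proj₁ (inj l ψₗ)

    hφ≈ψₗ : (h ∘H φ (suc k)) ≈H ψₗ
    hφ≈ψₗ = proj₂ (inj l ψₗ)

proposition4p4 : ∀ {ℓ v e : Level} (n : ℕ) → 2 ≤ n → (Λ : Set ℓ) (J : Λ → Quiver v e)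
    → (φ-injective n (∐ Λ J) → ((l : Λ) → φ-injective n (J l)))
    × (((l : Λ) → φ-injective n (J l)) → φ-injective n (∐ Λ J))
proposition4p4 (suc k) _ Λ J =
  ∐-φ-injective⇒φ-injective J (suc k) , φ-injective⇒∐-φ-injective J k
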